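{- Let $n\geq 1$ be an integer and let $a,b,x\in\mathbb{C}$. Then $$\sum_{k=0}^{n}\binom{n+k}{2k}C_k\, x^{2k}(b-x^2)^{n-k}= b\sum_{k=0}^{n-1}\binom{n-1}{k}M_k^{(a,b)}\,x^k\,(x^2-ax+b)^{n-1-k}.$$
   Context: $C_k=\frac{1}{k+1}\binom{2k}{k}$ denotes the $k$-th Catalan number. A Motzkin path of order $m\geq 0$ is a lattice path from $(0,0)$ to $(m,m)$ using steps $\mathbf{D}=(1,1)$, $\mathbf{N}_2=(0,2)$, $\mathbf{E}_2=(2,0)$ that never goes below the line $y=x$ (the empty path is the unique path of order $0$). The $(a,b)$-Motzkin number is $M_m^{(a,b)}=\sum_P a^{\#\mathbf{D}(P)}\,b^{\#\mathbf{E}_2(P)}$, the sum over all Motzkin paths $P$ of order $m$, where $\#\mathbf{D}(P)$ and $\#\mathbf{E}_2(P)$ are the numbers of $\mathbf{D}$ and $\mathbf{E}_2$ steps of $P$. Equivalently $M_m^{(a,b)}=\sum_{j=0}^{\lfloor m/2\rfloor}\binom{m}{2j}C_j a^{m-2j}b^j$. -}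

module Defs where

open import Level using (Level)
open import Data.Nat using (ℕ; zero; suc; _∸_) renaming (_+_ to _+ℕ_; _*_ to _*ℕ_)
open import Data.Nat.DivMod using (_/_)
open import Data.Nat.Combinatorics using (_C_)
open import Algebra.Bundles using (CommutativeRing; Semiring)

-- Catalan number C_k = (1/(k+1)) * binom(2k, k)  (exact division in ℕ)
catalan : ℕ → ℕ
catalan k = ((2 *ℕ k) C k) / suc k

module RingDefs {c ℓ : Level} (R : CommutativeRing c ℓ) where
  open CommutativeRing R
  open import Algebra.Definitions.RawSemiring (Semiring.rawSemiring semiring) public
    using (_^_; _×_)

  sumTo : ℕ → (ℕ → Carrier) → Carrier
  sumTo zero    f = f 0
  sumTo (suc n) f = sumTo n f + f (suc n)

  motzkin : Carrier → Carrier → ℕ → Carrier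
  motzkin a b m =
    sumTo (m / 2) (λ j → ((m C (2 *ℕ j)) *ℕ catalan j) × ((a ^ (m ∸ 2 *ℕ j)) * (b ^ j)))

module Submission where

open import Defs
open import Level using (Level)
open import Data.Nat using (ℕ; _≤_; _∸_) renaming (_+_ to _+ℕ_; _*_ to _*ℕ_)
open import Data.Nat.Combinatorics using (_C_)
open import Algebra.Bundles using (CommutativeRing)

open import Level using (_⊔_)
open import Data.Nat using (zero; suc; _<_; z≤n; s≤s; _≤?_)
import Data.Nat.Properties as ℕ
open import Data.Nat.Combinatorics using (nCn≡1)
open import Data.Nat.Combinatorics.Specification using (k>n⇒nCk≡0)
open import Data.Nat.DivMod using (_/_; m/n≤m)
open import Data.Nat.Tactic.RingSolver using (solve-∀)
open import Data.Empty using (⊥-elim)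
open import Data.Fin using (toℕ)
open import Data.Product using (_,_)
open import Function using (_∘_)
open import Relation.Nullary using (yes; no)
open import Relation.Binary.PropositionalEquality as ≡ using (_≡_)

-- Put u = x², v = b − x² (so u + v = b) and m = n − 1, and let φ, ψ be the power series in z with
--   φ = 1 + v z φ + u z φ²,   ψ = 1 + (u + b) z ψ + b u z² ψ².
-- Writing φ = (1 − v z)⁻¹ c(u z / (1 − v z)²), with c the Catalan series, shows that the left-hand
-- side is [z^n] φ.  Likewise [z^m] ψ = Σ_j C(m, 2j) C_j (b u)^j (u + b)^(m − 2j), and this is the
-- sum on the right once the Motzkin numbers are expanded and a is absorbed by the binomial theorem,
-- as a x + (x² − a x + b) = u + b.  So the theorem is φ = 1 + b z ψ.  Power series are never
-- multiplied: the powers φ^j satisfy a recurrence in j that determines them coefficientwise, and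
-- (1 + b z ψ)^j = Σ_i C(j, i) (b z ψ)^i is checked to satisfy the same recurrence.

module Combinatorics where
  open import Data.Nat using (_+_; _*_)
  open import Data.Nat.Properties
    using (+-comm; +-assoc; *-assoc; *-comm; *-identityʳ; *-zeroʳ; +-identityʳ; +-suc;
           *-cancelˡ-≡; +-cancelʳ-≡; *-distribˡ-+; m≤m+n; m+n∸m≡n; ≤-refl; ≰⇒>; <⇒≱)
  open import Data.Nat.Combinatorics using (nC1≡n; nCk≡nC[n∸k]; nCk+nC[k+1]≡[n+1]C[k+1])
  open import Data.Nat.DivMod using (m*n/n≡m; /-mono-≤)
  open import Relation.Binary.PropositionalEquality
  open ≡-Reasoning

  C-pascal : ∀ n k → suc n C suc k ≡ n C k + n C suc k
  C-pascal n k = sym (nCk+nC[k+1]≡[n+1]C[k+1] n k)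

  C-pascal′ : ∀ {n m} k → n ≡ suc m → n C suc k ≡ m C k + m C suc k
  C-pascal′ k refl = C-pascal _ k

  C-sym : ∀ {n} a b → n ≡ a + b → n C a ≡ n C b
  C-sym a b refl = begin
    (a + b) C a            ≡⟨ nCk≡nC[n∸k] (m≤m+n a b) ⟩
    (a + b) C (a + b ∸ a)  ≡⟨ cong ((a + b) C_) (m+n∸m≡n a b) ⟩
    (a + b) C b            ∎

  C-absorption : ∀ n k → suc k * (suc n C suc k) ≡ suc n * (n C k)
  C-absorption zero    zero    = refl
  C-absorption zero    (suc k) = *-zeroʳ (suc (suc k))
  C-absorption (suc n) zero    = trans (+-identityʳ _) (trans (nC1≡n (suc (suc n))) (sym (*-identityʳ _)))
  C-absorption (suc n) (suc k) = begin
    suc (suc k) * (suc (suc n) C suc (suc k))            ≡⟨ cong (suc (suc k) *_) (C-pascal (suc n) (suc k)) ⟩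
    suc (suc k) * (X + suc n C suc (suc k))              ≡⟨ expand (suc k) X (suc n C suc (suc k)) ⟩
    (suc k * X + X) + suc (suc k) * (suc n C suc (suc k))
      ≡⟨ cong₂ (λ p q → (p + X) + q) (C-absorption n k) (C-absorption n (suc k)) ⟩
    (suc n * (n C k) + X) + suc n * (n C suc k)          ≡⟨ collect (suc n) (n C k) (n C suc k) X ⟩
    suc n * (n C k + n C suc k) + X                      ≡⟨ cong (λ p → suc n * p + X) (C-pascal n k) ⟨
    suc n * X + X                                        ≡⟨ +-comm (suc n * X) X ⟩
    suc (suc n) * X                                      ∎
    where
    X = suc n C suc k
    expand : ∀ m x y → suc m * (x + y) ≡ (m * x + x) + suc m * y
    expand = solve-∀
    collect : ∀ m p q x → (m * p + x) + m * q ≡ m * (p + q) + x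
    collect = solve-∀

  C-trinomial : ∀ p r i → ((p + r) C (p + i)) * ((p + i) C p) ≡ ((p + r) C p) * (r C i)
  C-trinomial zero    r i = trans (*-identityʳ _) (sym (+-identityʳ _))
  C-trinomial (suc p) r i = *-cancelˡ-≡ _ _ (suc p) (begin
    suc p * (Bᵣᵢ * ((suc p + i) C suc p))              ≡⟨ x[yz]≡y[xz] (suc p) Bᵣᵢ _ ⟩
    Bᵣᵢ * (suc p * ((suc p + i) C suc p))              ≡⟨ cong (Bᵣᵢ *_) (C-absorption (p + i) p) ⟩
    Bᵣᵢ * (suc (p + i) * ((p + i) C p))                ≡⟨ x[yz]≡[yx]z Bᵣᵢ (suc (p + i)) _ ⟩
    (suc (p + i) * Bᵣᵢ) * ((p + i) C p)                ≡⟨ cong (_* ((p + i) C p)) (C-absorption (p + r) (p + i)) ⟩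
    (suc (p + r) * ((p + r) C (p + i))) * ((p + i) C p) ≡⟨ *-assoc (suc (p + r)) ((p + r) C (p + i)) _ ⟩
    suc (p + r) * (((p + r) C (p + i)) * ((p + i) C p)) ≡⟨ cong (suc (p + r) *_) (C-trinomial p r i) ⟩
    suc (p + r) * (((p + r) C p) * (r C i))             ≡⟨ *-assoc (suc (p + r)) ((p + r) C p) _ ⟨
    (suc (p + r) * ((p + r) C p)) * (r C i)             ≡⟨ cong (_* (r C i)) (C-absorption (p + r) p) ⟨
    (suc p * ((suc p + r) C suc p)) * (r C i)           ≡⟨ *-assoc (suc p) ((suc p + r) C suc p) _ ⟩
    suc p * (((suc p + r) C suc p) * (r C i))           ∎)
    where
    Bᵣᵢ = (suc p + r) C (suc p + i)
    x[yz]≡y[xz] : ∀ x y z → x * (y * z) ≡ y * (x * z)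
    x[yz]≡y[xz] = solve-∀
    x[yz]≡[yx]z : ∀ x y z → x * (y * z) ≡ (y * x) * z
    x[yz]≡[yx]z = solve-∀

  -- ballot k j is the coefficient of t^k in c(t)^j, where c = 1 + t c² is the Catalan
  -- generating function; the recursion is c^(j+1) = c^j + t c^(j+2).
  ballot : ℕ → ℕ → ℕ
  ballot zero    j       = 1
  ballot (suc k) zero    = 0
  ballot (suc k) (suc j) = ballot (suc k) j + ballot k (suc (suc j))

  -- The ballot formula [t^(k+1)] c^(j+1) = C(2k+j+2, k+1) − C(2k+j+2, k), with the
  -- subtracted term moved to the left.
  ballotRow : ℕ → ℕ → ℕ
  ballotRow k j = suc (suc (k + k + j))

  ballot-formula : ∀ k j → ballot (suc k) (suc j) + ballotRow k j C k ≡ ballotRow k j C suc k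
  ballot-formula zero    zero    = refl
  ballot-formula zero    (suc j) = begin
    (ballot 1 (suc j) + 1) + 1          ≡⟨ cong (_+ 1) (ballot-formula zero j) ⟩
    suc (suc j) C 1 + 1                 ≡⟨ +-comm _ 1 ⟩
    1 + suc (suc j) C 1                 ≡⟨ C-pascal (suc (suc j)) 0 ⟨
    suc (suc (suc j)) C 1               ∎
  ballot-formula (suc k) zero    = begin
    ballot (suc k) 2 + R C suc k                    ≡⟨ cong (ballot (suc k) 2 +_) (C-pascal′ k R≡1+R′) ⟩
    ballot (suc k) 2 + (R′ C k + R′ C suc k)        ≡⟨ +-assoc (ballot (suc k) 2) _ _ ⟨
    (ballot (suc k) 2 + R′ C k) + R′ C suc k        ≡⟨ cong (_+ R′ C suc k) (ballot-formula k 1) ⟩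
    R′ C suc k + R′ C suc k                         ≡⟨ cong (R′ C suc k +_) (C-sym (suc k) (suc (suc k)) R′≡) ⟩
    R′ C suc k + R′ C suc (suc k)                   ≡⟨ C-pascal′ (suc k) R≡1+R′ ⟨
    R C suc (suc k)                                 ∎
    where
    R  = ballotRow (suc k) 0
    R′ = ballotRow k 1
    R≡1+R′ : R ≡ suc R′
    R≡1+R′ = cong (suc ∘ suc) (index k)
      where index : ∀ k → suc k + suc k + 0 ≡ suc (k + k + 1)
            index = solve-∀
    R′≡ : R′ ≡ suc k + suc (suc k)
    R′≡ = index k
      where index : ∀ k → suc (suc (k + k + 1)) ≡ suc k + suc (suc k)
            index = solve-∀
  ballot-formula (suc k) (suc j) = begin
    (a + b) + R C suc k                     ≡⟨ cong (a + b +_) (C-pascal′ k R≡1+R′) ⟩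
    (a + b) + (R′ C k + R′ C suc k)         ≡⟨ [a+b]+[c+d]≡[a+d]+[b+c] a b _ _ ⟩
    (a + R′ C suc k) + (b + R′ C k)         ≡⟨ cong (λ n → (a + R′ C suc k) + (b + n C k)) R′≡ ⟩
    (a + R′ C suc k) + (b + R″ C k)         ≡⟨ cong₂ _+_ (ballot-formula (suc k) j) (ballot-formula k (suc (suc j))) ⟩
    R′ C suc (suc k) + R″ C suc k           ≡⟨ cong (λ n → R′ C suc (suc k) + n C suc k) R′≡ ⟨
    R′ C suc (suc k) + R′ C suc k           ≡⟨ +-comm (R′ C suc (suc k)) _ ⟩
    R′ C suc k + R′ C suc (suc k)           ≡⟨ C-pascal′ (suc k) R≡1+R′ ⟨
    R C suc (suc k)                         ∎
    where
    a  = ballot (suc (suc k)) (suc j)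
    b  = ballot (suc k) (suc (suc (suc j)))
    R  = ballotRow (suc k) (suc j)
    R′ = ballotRow (suc k) j
    R″ = ballotRow k (suc (suc j))
    R≡1+R′ : R ≡ suc R′
    R≡1+R′ = cong (suc ∘ suc) (+-suc (suc k + suc k) j)
    R′≡ : R′ ≡ R″
    R′≡ = cong (suc ∘ suc) (index k j)
      where index : ∀ k j → suc k + suc k + j ≡ k + k + suc (suc j)
            index = solve-∀
    [a+b]+[c+d]≡[a+d]+[b+c] : ∀ a b c d → (a + b) + (c + d) ≡ (a + d) + (b + c)
    [a+b]+[c+d]≡[a+d]+[b+c] = solve-∀

  private
    central-ratio : ∀ k → suc k * (ballotRow k 0 C suc k) ≡ suc (suc k) * (ballotRow k 0 C k)
    central-ratio k = begin
      suc k * (suc R C suc k)              ≡⟨ C-absorption R k ⟩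
      suc R * (R C k)                      ≡⟨ cong (suc R *_) (C-sym k (suc k) (row k)) ⟩
      suc R * (R C suc k)                  ≡⟨ C-absorption R (suc k) ⟨
      suc (suc k) * (suc R C suc (suc k))  ≡⟨ cong (suc (suc k) *_) (C-sym (suc (suc k)) k (cong suc (row′ k))) ⟩
      suc (suc k) * (suc R C k)            ∎
      where
      R = suc (k + k + 0)
      row : ∀ k → suc (k + k + 0) ≡ k + suc k
      row = solve-∀
      row′ : ∀ k → suc (k + k + 0) ≡ suc k + k
      row′ = solve-∀

  ballot-catalan : ∀ k → suc k * ballot k 1 ≡ (2 * k) C k
  ballot-catalan zero    = refl
  ballot-catalan (suc k) = trans (+-cancelʳ-≡ (suc k * X) _ _ step) (cong (_C suc k) (row k))
    where
    X = ballotRow k 0 C suc k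
    Y = ballotRow k 0 C k
    B = ballot (suc k) 1
    step : suc (suc k) * B + suc k * X ≡ X + suc k * X
    step = begin
      suc (suc k) * B + suc k * X        ≡⟨ cong (suc (suc k) * B +_) (central-ratio k) ⟩
      suc (suc k) * B + suc (suc k) * Y  ≡⟨ *-distribˡ-+ (suc (suc k)) B Y ⟨
      suc (suc k) * (B + Y)              ≡⟨ cong (suc (suc k) *_) (ballot-formula k 0) ⟩
      suc (suc k) * X                    ∎
    row : ∀ k → suc (suc (k + k + 0)) ≡ 2 * suc k
    row = solve-∀

  catalan≡ballot : ∀ k → catalan k ≡ ballot k 1
  catalan≡ballot k = begin
    ((2 * k) C k) / suc k       ≡⟨ cong (_/ suc k) (trans (*-comm (ballot k 1) (suc k)) (ballot-catalan k)) ⟨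
    ballot k 1 * suc k / suc k  ≡⟨ m*n/n≡m (ballot k 1) (suc k) ⟩
    ballot k 1                  ∎

  half<⇒<double : ∀ {k j} → k / 2 < j → k < 2 * j
  half<⇒<double {k} {j} k/2<j = ≰⇒> (λ 2j≤k → <⇒≱ k/2<j (halve 2j≤k))
    where
    halve : 2 * j ≤ k → j ≤ k / 2
    halve 2j≤k = subst (_≤ k / 2) (m*n/n≡m j 2) (/-mono-≤ (subst (_≤ k) (*-comm 2 j) 2j≤k) (≤-refl {2}))

open Combinatorics

module FiniteSums {c ℓ : Level} (R : CommutativeRing c ℓ) where
  open CommutativeRing R
  open RingDefs R
  open import Algebra.Properties.Monoid.Sum +-monoid using (sum)
  open import Algebra.Properties.Monoid.Mult +-monoid using (×-congʳ; ×-homo-+; ×-assocˡ)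
  open import Algebra.Properties.CommutativeMonoid.Mult +-commutativeMonoid using (×-distrib-+)
  open import Algebra.Properties.Semiring.Mult semiring using (×-comm-*)
  open import Algebra.Properties.CommutativeSemigroup +-commutativeSemigroup using (interchange; x∙yz≈xz∙y)
  import Algebra.Properties.CommutativeSemiring.Binomial commutativeSemiring as Binomial
  open import Relation.Binary.Reasoning.Setoid setoid

  ×-zeroʳ : ∀ n → n × 0# ≈ 0#
  ×-zeroʳ zero    = refl
  ×-zeroʳ (suc n) = trans (+-identityˡ _) (×-zeroʳ n)

  ×-*-× : ∀ m n x y → m × (x * (n × y)) ≈ (n *ℕ m) × (x * y)
  ×-*-× m n x y = trans (×-congʳ m (×-comm-* n x y)) (trans (×-assocˡ (x * y) m n) (reflexive (≡.cong (_× (x * y)) (ℕ.*-comm m n))))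

  sumTo-cong : ∀ n {f g : ℕ → Carrier} → (∀ i → i ≤ n → f i ≈ g i) → sumTo n f ≈ sumTo n g
  sumTo-cong zero    f≈g = f≈g 0 z≤n
  sumTo-cong (suc n) f≈g = +-cong (sumTo-cong n (λ i i≤n → f≈g i (ℕ.m≤n⇒m≤1+n i≤n))) (f≈g (suc n) ℕ.≤-refl)

  sumTo-zero : ∀ n {f} → (∀ i → i ≤ n → f i ≈ 0#) → sumTo n f ≈ 0#
  sumTo-zero zero    f≈0 = f≈0 0 z≤n
  sumTo-zero (suc n) f≈0 =
    trans (+-cong (sumTo-zero n (λ i i≤n → f≈0 i (ℕ.m≤n⇒m≤1+n i≤n))) (f≈0 (suc n) ℕ.≤-refl)) (+-identityˡ 0#)

  sumTo-distrib-+ : ∀ n f g → sumTo n (λ i → f i + g i) ≈ sumTo n f + sumTo n g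
  sumTo-distrib-+ zero    f g = refl
  sumTo-distrib-+ (suc n) f g = trans (+-congʳ (sumTo-distrib-+ n f g)) (interchange _ _ _ _)

  *-distribˡ-sumTo : ∀ n x f → x * sumTo n f ≈ sumTo n (λ i → x * f i)
  *-distribˡ-sumTo zero    x f = refl
  *-distribˡ-sumTo (suc n) x f = trans (distribˡ x _ _) (+-congʳ (*-distribˡ-sumTo n x f))

  *-distribʳ-sumTo : ∀ n x f → sumTo n f * x ≈ sumTo n (λ i → f i * x)
  *-distribʳ-sumTo zero    x f = refl
  *-distribʳ-sumTo (suc n) x f = trans (distribʳ x _ _) (+-congʳ (*-distribʳ-sumTo n x f))

  ×-distrib-sumTo : ∀ n m f → m × sumTo n f ≈ sumTo n (λ i → m × f i)
  ×-distrib-sumTo zero    m f = refl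
  ×-distrib-sumTo (suc n) m f = trans (×-distrib-+ _ _ m) (+-congʳ (×-distrib-sumTo n m f))

  sumTo-head-tail : ∀ n f → sumTo (suc n) f ≈ f 0 + sumTo n (f ∘ suc)
  sumTo-head-tail zero    f = refl
  sumTo-head-tail (suc n) f = trans (+-congʳ (sumTo-head-tail n f)) (+-assoc _ _ _)

  sumTo-extend : ∀ {n N} f → n ≤ N → (∀ i → n < i → f i ≈ 0#) → sumTo N f ≈ sumTo n f
  sumTo-extend {n} {N} f n≤N f≈0 = trans (reflexive (≡.cong (λ N → sumTo N f) (≡.sym (ℕ.m∸n+n≡m n≤N)))) (extendBy (N ∸ n))
    where
    extendBy : ∀ d → sumTo (d +ℕ n) f ≈ sumTo n f
    extendBy zero    = refl
    extendBy (suc d) = trans (+-cong (extendBy d) (f≈0 (suc (d +ℕ n)) (s≤s (ℕ.m≤n+m n d)))) (+-identityʳ _)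

  sumTo-drop : ∀ p r f → (∀ i → i < p → f i ≈ 0#) → sumTo (p +ℕ r) f ≈ sumTo r (λ i → f (p +ℕ i))
  sumTo-drop zero    r f f≈0 = refl
  sumTo-drop (suc p) r f f≈0 = begin
    sumTo (suc (p +ℕ r)) f
      ≈⟨ sumTo-head-tail (p +ℕ r) f ⟩
    f 0 + sumTo (p +ℕ r) (f ∘ suc)
      ≈⟨ +-cong (f≈0 0 (s≤s z≤n)) (sumTo-drop p r (f ∘ suc) (λ i i<p → f≈0 (suc i) (s≤s i<p))) ⟩
    0# + sumTo r (λ i → f (suc p +ℕ i))
      ≈⟨ +-identityˡ _ ⟩
    sumTo r (λ i → f (suc p +ℕ i))
      ∎

  sumTo-comm : ∀ n m (f : ℕ → ℕ → Carrier) → sumTo n (λ i → sumTo m (f i)) ≈ sumTo m (λ j → sumTo n (λ i → f i j))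
  sumTo-comm zero    m f = refl
  sumTo-comm (suc n) m f = trans (+-congʳ (sumTo-comm n m f)) (sym (sumTo-distrib-+ m _ _))

  sumTo-pascal : ∀ j (w : ℕ → Carrier) →
    sumTo (suc j) (λ i → (suc j C i) × w i) ≈ sumTo j (λ i → (j C i) × w i) + sumTo j (λ i → (j C i) × w (suc i))
  sumTo-pascal j w = begin
    sumTo (suc j) (λ i → (suc j C i) × w i)
      ≈⟨ sumTo-head-tail j _ ⟩
    1 × w 0 + sumTo j (λ i → (suc j C suc i) × w (suc i))
      ≈⟨ +-congˡ (trans (sumTo-cong j (λ i _ → pascal-term i)) (sumTo-distrib-+ j _ _)) ⟩
    1 × w 0 + (sumTo j (λ i → (j C i) × w (suc i)) + sumTo j (λ i → (j C suc i) × w (suc i)))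
      ≈⟨ x∙yz≈xz∙y _ _ _ ⟩
    (1 × w 0 + sumTo j (λ i → (j C suc i) × w (suc i))) + sumTo j (λ i → (j C i) × w (suc i))
      ≈⟨ +-congʳ (sym (sumTo-head-tail j (λ i → (j C i) × w i))) ⟩
    sumTo (suc j) (λ i → (j C i) × w i) + sumTo j (λ i → (j C i) × w (suc i))
      ≈⟨ +-congʳ (sumTo-extend _ (ℕ.n≤1+n j) (λ i j<i → reflexive (≡.cong (_× w i) (k>n⇒nCk≡0 j<i)))) ⟩
    sumTo j (λ i → (j C i) × w i) + sumTo j (λ i → (j C i) × w (suc i))
      ∎
    where
    pascal-term : ∀ i → (suc j C suc i) × w (suc i) ≈ (j C i) × w (suc i) + (j C suc i) × w (suc i)
    pascal-term i = trans (reflexive (≡.cong (_× w (suc i)) (C-pascal j i))) (×-homo-+ _ (j C i) _)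

  sumTo≈sum : ∀ n f → sumTo n f ≈ sum (f ∘ toℕ {suc n})
  sumTo≈sum zero    f = sym (+-identityʳ _)
  sumTo≈sum (suc n) f = trans (sumTo-head-tail n f) (+-congˡ (sumTo≈sum n (f ∘ suc)))

  binomial-theorem : ∀ n x y → sumTo n (λ i → (n C i) × (x ^ i * y ^ (n ∸ i))) ≈ (x + y) ^ n
  binomial-theorem n x y = trans (sumTo≈sum n _) (sym (Binomial.theorem n x y))


module PowerSeries {c ℓ : Level} (R : CommutativeRing c ℓ) where
  open CommutativeRing R
  open RingDefs R
  open FiniteSums R
  open import Algebra.Properties.Monoid.Mult +-monoid using (×-homo-1; ×-homo-+)
  open import Algebra.Properties.Semiring.Mult semiring using (×-comm-*)
  open import Relation.Binary.Reasoning.Setoid setoid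

  -- Formal power series over R as coefficient sequences; shift k is multiplication by z^k.
  Series : Set c
  Series = ℕ → Carrier

  infix  4 _≐_
  infixl 6 _⊕_
  infixl 7 _·_

  _≐_ : Series → Series → Set ℓ
  s ≐ t = ∀ n → s n ≈ t n

  _⊕_ : Series → Series → Series
  (s ⊕ t) n = s n + t n

  _·_ : Carrier → Series → Series
  (x · s) n = x * s n

  one : Series
  one zero    = 1#
  one (suc n) = 0#

  shift : ℕ → Series → Series
  shift zero    t n       = t n
  shift (suc k) t zero    = 0#
  shift (suc k) t (suc n) = shift k t n

  shift-cong : ∀ k {s t} → s ≐ t → shift k s ≐ shift k t
  shift-cong zero    s≐t n       = s≐t n
  shift-cong (suc k) s≐t zero    = refl
  shift-cong (suc k) s≐t (suc n) = shift-cong k s≐t n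

  shift-⊕ : ∀ k s t → shift k (s ⊕ t) ≐ shift k s ⊕ shift k t
  shift-⊕ zero    s t n       = refl
  shift-⊕ (suc k) s t zero    = sym (+-identityʳ 0#)
  shift-⊕ (suc k) s t (suc n) = shift-⊕ k s t n

  shift-· : ∀ k x s → shift k (x · s) ≐ x · shift k s
  shift-· zero    x s n       = refl
  shift-· (suc k) x s zero    = sym (zeroʳ x)
  shift-· (suc k) x s (suc n) = shift-· k x s n

  shift-zero : ∀ k {t} → (∀ n → t n ≈ 0#) → ∀ n → shift k t n ≈ 0#
  shift-zero zero    t≈0 n       = t≈0 n
  shift-zero (suc k) t≈0 zero    = refl
  shift-zero (suc k) t≈0 (suc n) = shift-zero k t≈0 n

  shift-+ : ∀ a b t → shift (a +ℕ b) t ≐ shift a (shift b t)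
  shift-+ zero    b t n       = refl
  shift-+ (suc a) b t zero    = refl
  shift-+ (suc a) b t (suc n) = shift-+ a b t n

  shift-comm : ∀ a b t → shift a (shift b t) ≐ shift b (shift a t)
  shift-comm a b t n = trans (sym (shift-+ a b t n))
    (trans (reflexive (≡.cong (λ k → shift k t n) (ℕ.+-comm a b))) (shift-+ b a t n))

  shift-eval : ∀ k t n → shift k t (k +ℕ n) ≡ t n
  shift-eval zero    t n = ≡.refl
  shift-eval (suc k) t n = shift-eval k t n

  shift-vanish : ∀ k t {n} → n < k → shift k t n ≡ 0#
  shift-vanish (suc k) t {zero}  _         = ≡.refl
  shift-vanish (suc k) t {suc n} (s≤s n<k) = shift-vanish k t n<k

  -- For s ≥ 1 the terms with k > n vanish at z^n, so Σshift s T = Σ_k z^(s k) T_k.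
  Σshift : ℕ → (ℕ → Series) → Series
  Σshift s T n = sumTo n (λ k → shift (k *ℕ s) (T k) n)

  module _ (s′ : ℕ) where
    private
      s = suc s′

    shift-multiple-vanish : ∀ k t {n} → n < k → shift (k *ℕ s) t n ≡ 0#
    shift-multiple-vanish k t n<k = shift-vanish (k *ℕ s) t (ℕ.<-≤-trans n<k (ℕ.m≤m*n k s))

    Σshift-cong : ∀ {T T′} → (∀ k → T k ≐ T′ k) → Σshift s T ≐ Σshift s T′
    Σshift-cong T≐T′ n = sumTo-cong n (λ k _ → shift-cong (k *ℕ s) (T≐T′ k) n)

    Σshift-⊕ : ∀ T T′ → Σshift s (λ k → T k ⊕ T′ k) ≐ Σshift s T ⊕ Σshift s T′
    Σshift-⊕ T T′ n = trans (sumTo-cong n (λ k _ → shift-⊕ (k *ℕ s) (T k) (T′ k) n)) (sumTo-distrib-+ n _ _)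

    Σshift-· : ∀ x T → Σshift s (λ k → x · T k) ≐ x · Σshift s T
    Σshift-· x T n = trans (sumTo-cong n (λ k _ → shift-· (k *ℕ s) x (T k) n)) (sym (*-distribˡ-sumTo n x _))

    Σshift-shift₁ : ∀ T → Σshift s (λ k → shift 1 (T k)) ≐ shift 1 (Σshift s T)
    Σshift-shift₁ T zero    = refl
    Σshift-shift₁ T (suc n) = begin
      sumTo (suc n) (λ k → shift (k *ℕ s) (shift 1 (T k)) (suc n))
        ≈⟨ sumTo-cong (suc n) (λ k _ → shift-comm (k *ℕ s) 1 (T k) (suc n)) ⟩
      sumTo (suc n) (λ k → shift (k *ℕ s) (T k) n)
        ≈⟨ sumTo-extend _ (ℕ.n≤1+n n) (λ k n<k → reflexive (shift-multiple-vanish k (T k) n<k)) ⟩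
      sumTo n (λ k → shift (k *ℕ s) (T k) n)
        ∎

    Σshift-head : ∀ T → Σshift s T ≐ T 0 ⊕ shift s (Σshift s (T ∘ suc))
    Σshift-head T n with s ≤? n
    ... | no  n≱s = begin
      Σshift s T n                              ≈⟨ sumTo-extend {N = n} _ z≤n tail≈0 ⟩
      T 0 n                                     ≈⟨ +-identityʳ _ ⟨
      T 0 n + 0#                                ≈⟨ +-congˡ (reflexive (shift-vanish s _ (ℕ.≰⇒> n≱s))) ⟨
      T 0 n + shift s (Σshift s (T ∘ suc)) n    ∎
      where
      tail≈0 : ∀ k → 0 < k → shift (k *ℕ s) (T k) n ≈ 0#
      tail≈0 (suc k) _ = reflexive (shift-vanish (suc k *ℕ s) (T (suc k)) (ℕ.<-≤-trans (ℕ.≰⇒> n≱s) (ℕ.m≤m+n s (k *ℕ s))))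
    ... | yes s≤n with ℕ.m≤n⇒∃[o]m+o≡n s≤n
    ...   | m , ≡.refl = begin
      Σshift s T (s +ℕ m)
        ≈⟨ sumTo-head-tail (s′ +ℕ m) _ ⟩
      T 0 (s +ℕ m) + sumTo (s′ +ℕ m) (λ k → shift (s +ℕ k *ℕ s) (T (suc k)) (s +ℕ m))
        ≈⟨ +-congˡ (sumTo-cong (s′ +ℕ m) (λ k _ → trans (shift-+ s (k *ℕ s) (T (suc k)) (s +ℕ m)) (reflexive (shift-eval s _ m)))) ⟩
      T 0 (s +ℕ m) + sumTo (s′ +ℕ m) (λ k → shift (k *ℕ s) (T (suc k)) m)
        ≈⟨ +-congˡ (sumTo-extend _ (ℕ.m≤n+m m s′) (λ k m<k → reflexive (shift-multiple-vanish k (T (suc k)) m<k))) ⟩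
      T 0 (s +ℕ m) + sumTo m (λ k → shift (k *ℕ s) (T (suc k)) m)
        ≈⟨ +-congˡ (reflexive (shift-eval s (Σshift s (T ∘ suc)) m)) ⟨
      T 0 (s +ℕ m) + shift s (Σshift s (T ∘ suc)) (s +ℕ m)
        ∎

  -- invPower A d is the series (1 − A z)^(−d).
  invPower : Carrier → ℕ → Series
  invPower A zero      = one
  invPower A (suc e) n = ((n +ℕ e) C e) × A ^ n

  invPower-suc : ∀ A d → invPower A (suc d) ≐ invPower A d ⊕ A · shift 1 (invPower A (suc d))
  invPower-suc A zero    zero    = +-congˡ (sym (zeroʳ A))
  invPower-suc A zero    (suc n) = trans (×-homo-1 _) (trans (*-congˡ (sym (×-homo-1 _))) (sym (+-identityˡ _)))
  invPower-suc A (suc e) zero    = trans (reflexive (≡.cong (_× 1#) (≡.trans (nCn≡1 (suc e)) (≡.sym (nCn≡1 e)))))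
                                         (sym (trans (+-congˡ (zeroʳ A)) (+-identityʳ _)))
  invPower-suc A (suc e) (suc n) = begin
    ((suc n +ℕ suc e) C suc e) × A ^ suc n
      ≈⟨ reflexive (≡.cong (_× A ^ suc n) (C-pascal (n +ℕ suc e) e)) ⟩
    ((n +ℕ suc e) C e +ℕ (n +ℕ suc e) C suc e) × A ^ suc n
      ≈⟨ ×-homo-+ _ ((n +ℕ suc e) C e) _ ⟩
    ((n +ℕ suc e) C e) × A ^ suc n + ((n +ℕ suc e) C suc e) × (A * A ^ n)
      ≈⟨ +-cong (reflexive (≡.cong (λ m → (m C e) × A ^ suc n) (ℕ.+-suc n e))) (sym (×-comm-* ((n +ℕ suc e) C suc e) A (A ^ n))) ⟩
    ((suc n +ℕ e) C e) × A ^ suc n + A * ((n +ℕ suc e) C suc e) × A ^ n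
      ∎

module CatalanSeries {c ℓ : Level} (R : CommutativeRing c ℓ) where
  open CommutativeRing R
  open RingDefs R
  open FiniteSums R
  open PowerSeries R
  open import Algebra.Properties.Monoid.Mult +-monoid using (×-congʳ; ×-homo-1; ×-homo-+)
  open import Algebra.Properties.CommutativeMonoid.Mult +-commutativeMonoid using (×-distrib-+)
  open import Algebra.Properties.Semiring.Mult semiring using (×-comm-*)
  open import Algebra.Properties.CommutativeSemigroup +-commutativeSemigroup using (xy∙z≈xz∙y)
  open import Algebra.Properties.CommutativeSemigroup *-commutativeSemigroup using (x∙yz≈y∙xz)
  open import Algebra.Solver.Ring.NaturalCoefficients.Default commutativeSemiring using (solve; _:=_; _:+_; _:*_)
  open import Relation.Binary.Reasoning.Setoid setoid

  -- Φ j = (1 − A z)^(−j) c(W z^s / (1 − A z)²)^j, expanded by the ballot numbers.  Thus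
  -- Φ j = (Φ 1)^j with Φ 1 = 1 + A z Φ 1 + W z^s (Φ 1)², and Φ-suc is this equation times (Φ 1)^j.
  module CatalanFamily (s′ : ℕ) (A W : Carrier) where
    s : ℕ
    s = suc s′

    term : ℕ → ℕ → Series
    term j k n = ballot k j × (W ^ k * invPower A (j +ℕ 2 *ℕ k) n)

    Φ : ℕ → Series
    Φ j = Σshift s (term j)

    Φ-zero : Φ 0 ≐ one
    Φ-zero n = begin
      Φ 0 n                                             ≈⟨ Σshift-head s′ (term 0) n ⟩
      term 0 0 n + shift s (Σshift s (term 0 ∘ suc)) n  ≈⟨ +-congˡ (shift-zero s tail≈0 n) ⟩
      term 0 0 n + 0#                                   ≈⟨ +-identityʳ _ ⟩
      1 × (1# * one n)                                  ≈⟨ trans (×-homo-1 _) (*-identityˡ _) ⟩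
      one n                                             ∎
      where
      tail≈0 : ∀ m → Σshift s (term 0 ∘ suc) m ≈ 0#
      tail≈0 m = sumTo-zero m (λ k _ → shift-zero (k *ℕ s) (λ _ → refl) m)

    private
      term′ : ℕ → ℕ → Series
      term′ j k n = ballot k (suc j) × (W ^ k * invPower A (j +ℕ 2 *ℕ k) n)

      term-suc : ∀ j k → term (suc j) k ≐ term′ j k ⊕ A · shift 1 (term (suc j) k)
      term-suc j k n = begin
        b × (W ^ k * invPower A (suc d) n)
          ≈⟨ ×-congʳ b (*-congˡ (invPower-suc A d n)) ⟩
        b × (W ^ k * (invPower A d n + A * shift 1 (invPower A (suc d)) n))
          ≈⟨ ×-congʳ b (trans (distribˡ _ _ _) (+-congˡ (x∙yz≈y∙xz _ A _))) ⟩
        b × (W ^ k * invPower A d n + A * (W ^ k * shift 1 (invPower A (suc d)) n))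
          ≈⟨ trans (×-distrib-+ _ _ b) (+-congˡ (sym (×-comm-* b A _))) ⟩
        term′ j k n + A * (b × (W ^ k * shift 1 (invPower A (suc d)) n))
          ≈⟨ +-congˡ (*-congˡ (shift-scaled n)) ⟩
        term′ j k n + A * shift 1 (term (suc j) k) n
          ∎
        where
        b = ballot k (suc j)
        d = j +ℕ 2 *ℕ k
        shift-scaled : ∀ n → b × (W ^ k * shift 1 (invPower A (suc d)) n) ≈ shift 1 (term (suc j) k) n
        shift-scaled zero    = trans (×-congʳ b (zeroʳ _)) (×-zeroʳ b)
        shift-scaled (suc n) = refl

      term′-suc : ∀ j k → term′ j (suc k) ≐ term j (suc k) ⊕ W · term (suc (suc j)) k
      term′-suc j k n = trans (×-homo-+ _ (ballot (suc k) j) b) (+-congˡ (trans (×-congʳ b reindex) (sym (×-comm-* b W _))))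
        where
        b = ballot k (suc (suc j))
        index : ∀ j k → j +ℕ 2 *ℕ suc k ≡ suc (suc j) +ℕ 2 *ℕ k
        index = solve-∀
        reindex : W ^ suc k * invPower A (j +ℕ 2 *ℕ suc k) n ≈ W * (W ^ k * invPower A (suc (suc j) +ℕ 2 *ℕ k) n)
        reindex = trans (*-congˡ (reflexive (≡.cong (λ d → invPower A d n) (index j k)))) (*-assoc W _ _)

    Φ-suc : ∀ j → Φ (suc j) ≐ Φ j ⊕ A · shift 1 (Φ (suc j)) ⊕ W · shift s (Φ (suc (suc j)))
    Φ-suc j n = begin
      Φ (suc j) n
        ≈⟨ Σshift-cong s′ (term-suc j) n ⟩
      Σshift s (λ k → term′ j k ⊕ A · shift 1 (term (suc j) k)) n
        ≈⟨ Σshift-⊕ s′ _ _ n ⟩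
      Σshift s (term′ j) n + Σshift s (λ k → A · shift 1 (term (suc j) k)) n
        ≈⟨ +-cong (Σshift-head s′ (term′ j) n) (trans (Σshift-· s′ A _ n) (*-congˡ (Σshift-shift₁ s′ (term (suc j)) n))) ⟩
      (term j 0 n + shift s (Σshift s (term′ j ∘ suc)) n) + A * shift 1 (Φ (suc j)) n
        ≈⟨ +-congʳ (+-congˡ (tail n)) ⟩
      (term j 0 n + (shift s (Σshift s (term j ∘ suc)) n + W * shift s (Φ (suc (suc j))) n)) + A * shift 1 (Φ (suc j)) n
        ≈⟨ trans (+-congʳ (sym (+-assoc _ _ _))) (xy∙z≈xz∙y _ _ _) ⟩
      ((term j 0 n + shift s (Σshift s (term j ∘ suc)) n) + A * shift 1 (Φ (suc j)) n) + W * shift s (Φ (suc (suc j))) n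
        ≈⟨ +-congʳ (+-congʳ (sym (Σshift-head s′ (term j) n))) ⟩
      (Φ j n + A * shift 1 (Φ (suc j)) n) + W * shift s (Φ (suc (suc j))) n
        ∎
      where
      tail′ : Σshift s (term′ j ∘ suc) ≐ Σshift s (term j ∘ suc) ⊕ W · Φ (suc (suc j))
      tail′ m = trans (Σshift-cong s′ (term′-suc j) m)
                      (trans (Σshift-⊕ s′ _ _ m) (+-congˡ (Σshift-· s′ W _ m)))
      tail : shift s (Σshift s (term′ j ∘ suc)) ≐ shift s (Σshift s (term j ∘ suc)) ⊕ W · shift s (Φ (suc (suc j)))
      tail m = trans (shift-cong s tail′ m) (trans (shift-⊕ s _ _ m) (+-congˡ (shift-· s W _ m)))

    Φ₁-coeff : ∀ n → Φ 1 n ≈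
      sumTo n (λ k → ((((n +ℕ 2 *ℕ k) ∸ k *ℕ s) C (2 *ℕ k)) *ℕ catalan k) × (W ^ k * A ^ (n ∸ k *ℕ s)))
    Φ₁-coeff n = sumTo-cong n (λ k _ → coeff k)
      where
      coefficient : ℕ → Carrier
      coefficient k = ((((n +ℕ 2 *ℕ k) ∸ k *ℕ s) C (2 *ℕ k)) *ℕ catalan k) × (W ^ k * A ^ (n ∸ k *ℕ s))
      coeff : ∀ k → shift (k *ℕ s) (term 1 k) n ≈ coefficient k
      coeff k with k *ℕ s ≤? n
      ... | yes ks≤n with ℕ.m≤n⇒∃[o]m+o≡n ks≤n
      ...   | r , ≡.refl = begin
        shift (k *ℕ s) (term 1 k) (k *ℕ s +ℕ r)
          ≈⟨ reflexive (shift-eval (k *ℕ s) (term 1 k) r) ⟩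
        ballot k 1 × (W ^ k * B × A ^ r)
          ≈⟨ ×-*-× (ballot k 1) B (W ^ k) (A ^ r) ⟩
        (B *ℕ ballot k 1) × (W ^ k * A ^ r)
          ≈⟨ reflexive (≡.cong (λ b → (B *ℕ b) × (W ^ k * A ^ r)) (catalan≡ballot k)) ⟨
        (B *ℕ catalan k) × (W ^ k * A ^ r)
          ≈⟨ reflexive (≡.cong₂ (λ a b → ((a C (2 *ℕ k)) *ℕ catalan k) × (W ^ k * A ^ b))
                                (≡.sym row) (≡.sym (ℕ.m+n∸m≡n (k *ℕ s) r))) ⟩
        coefficient k
          ∎
        where
        B = (r +ℕ 2 *ℕ k) C (2 *ℕ k)
        row : (k *ℕ s +ℕ r +ℕ 2 *ℕ k) ∸ k *ℕ s ≡ r +ℕ 2 *ℕ k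
        row = ≡.trans (≡.cong (_∸ k *ℕ s) (ℕ.+-assoc (k *ℕ s) r (2 *ℕ k))) (ℕ.m+n∸m≡n (k *ℕ s) _)
      coeff (suc k) | no ks≰n = begin
        shift (suc k *ℕ s) (term 1 (suc k)) n
          ≈⟨ reflexive (shift-vanish (suc k *ℕ s) _ n<ks) ⟩
        0#
          ≈⟨ reflexive (≡.cong (λ c → (c *ℕ catalan (suc k)) × (W ^ suc k * A ^ (n ∸ suc k *ℕ s))) (k>n⇒nCk≡0 row<2k)) ⟨
        coefficient (suc k)
          ∎
        where
        n<ks = ℕ.≰⇒> ks≰n
        row<2k : (n +ℕ 2 *ℕ suc k) ∸ suc k *ℕ s < 2 *ℕ suc k
        row<2k = ℕ.m<n+o⇒m∸n<o (n +ℕ 2 *ℕ suc k) (suc k *ℕ s) (ℕ.+-monoˡ-< (2 *ℕ suc k) n<ks)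
      coeff zero | no 0≰n = ⊥-elim (0≰n z≤n)

  -- The equations satisfied by S j = φ^j, where φ = 1 + A z φ + W z φ².
  record RootPowers (A W : Carrier) (S : ℕ → Series) : Set (c ⊔ ℓ) where
    field
      base : S 0 ≐ one
      step : ∀ j → S (suc j) ≐ S j ⊕ A · shift 1 (S (suc j)) ⊕ W · shift 1 (S (suc (suc j)))

  module _ {A W : Carrier} where
    open RootPowers

    RootPowers-at-0 : ∀ {S} → RootPowers A W S → ∀ j → S j 0 ≈ 1#
    RootPowers-at-0 S zero    = base S 0
    RootPowers-at-0 S (suc j) = trans (step S j 0) (trans (+-cong (+-cong (RootPowers-at-0 S j) (zeroʳ A)) (zeroʳ W))
                                                          (trans (+-identityʳ _) (+-identityʳ _)))

    RootPowers-unique : ∀ {S S′} → RootPowers A W S → RootPowers A W S′ → ∀ j n → S j n ≈ S′ j n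
    RootPowers-unique S S′ j       zero    = trans (RootPowers-at-0 S j) (sym (RootPowers-at-0 S′ j))
    RootPowers-unique S S′ zero    (suc n) = trans (base S (suc n)) (sym (base S′ (suc n)))
    RootPowers-unique S S′ (suc j) (suc n) = trans (step S j (suc n)) (trans
      (+-cong (+-cong (RootPowers-unique S S′ j (suc n)) (*-congˡ (RootPowers-unique S S′ (suc j) n)))
              (*-congˡ (RootPowers-unique S S′ (suc (suc j)) n)))
      (sym (step S′ j (suc n))))

  binomialTransform : (ℕ → Series) → ℕ → Series
  binomialTransform q j n = sumTo j (λ i → (j C i) × q i n)

  -- With q i = w^i, binomialTransform q j = (1 + w)^j; if w = b z + α z w + W z w², then
  -- 1 + w solves φ = 1 + A z φ + W z φ², because (b, α) = (W + A, 2W + A).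
  binomialTransform-RootPowers : ∀ {A W b α} → b ≈ W + A → α ≈ W + b → ∀ q → q 0 ≐ one →
    (∀ i → q (suc i) ≐ b · shift 1 (q i) ⊕ α · shift 1 (q (suc i)) ⊕ W · shift 1 (q (suc (suc i)))) →
    RootPowers A W (binomialTransform q)
  binomialTransform-RootPowers {A} {W} {b} {α} b≈W+A α≈W+b q q-base q-step =
    record { base = λ n → trans (×-homo-1 _) (q-base n) ; step = step }
    where
    Y = binomialTransform q

    S₁ S₂ : ℕ → Series
    S₁ j n = sumTo j (λ i → (j C i) × q (suc i) n)
    S₂ j n = sumTo j (λ i → (j C i) × q (suc (suc i)) n)

    Y-suc : ∀ j n → Y (suc j) n ≈ Y j n + S₁ j n
    Y-suc j n = sumTo-pascal j (λ i → q i n)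

    Y-suc-suc : ∀ j n → Y (suc (suc j)) n ≈ (Y j n + S₁ j n) + (S₁ j n + S₂ j n)
    Y-suc-suc j n = trans (Y-suc (suc j) n) (+-cong (Y-suc j n) (sumTo-pascal j (λ i → q (suc i) n)))

    S₁-at-0 : ∀ j → S₁ j 0 ≈ 0#
    S₁-at-0 j = sumTo-zero j (λ i _ → trans (×-congʳ (j C i) (q-suc-at-0 i)) (×-zeroʳ (j C i)))
      where
      q-suc-at-0 : ∀ i → q (suc i) 0 ≈ 0#
      q-suc-at-0 i = trans (q-step i 0) (trans (+-cong (+-cong (zeroʳ b) (zeroʳ α)) (zeroʳ W))
                                               (trans (+-identityʳ _) (+-identityʳ _)))

    S₁-suc : ∀ j m → S₁ j (suc m) ≈ (b * Y j m + α * S₁ j m) + W * S₂ j m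
    S₁-suc j m = begin
      S₁ j (suc m)
        ≈⟨ sumTo-cong j (λ i _ → ×-congʳ (j C i) (q-step i (suc m))) ⟩
      sumTo j (λ i → (j C i) × ((b * q i m + α * q (suc i) m) + W * q (suc (suc i)) m))
        ≈⟨ sumTo-cong j (λ i _ → trans (×-distrib-+ _ _ (j C i)) (+-congʳ (×-distrib-+ _ _ (j C i)))) ⟩
      sumTo j (λ i → ((j C i) × (b * q i m) + (j C i) × (α * q (suc i) m)) + (j C i) × (W * q (suc (suc i)) m))
        ≈⟨ trans (sumTo-distrib-+ j _ _) (+-congʳ (sumTo-distrib-+ j _ _)) ⟩
      (sumTo j (λ i → (j C i) × (b * q i m)) + sumTo j (λ i → (j C i) × (α * q (suc i) m)))
        + sumTo j (λ i → (j C i) × (W * q (suc (suc i)) m))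
        ≈⟨ +-cong (+-cong (pull b (λ i → q i m)) (pull α (λ i → q (suc i) m))) (pull W (λ i → q (suc (suc i)) m)) ⟩
      (b * Y j m + α * S₁ j m) + W * S₂ j m
        ∎
      where
      pull : ∀ x f → sumTo j (λ i → (j C i) × (x * f i)) ≈ x * sumTo j (λ i → (j C i) × f i)
      pull x f = trans (sumTo-cong j (λ i _ → sym (×-comm-* (j C i) x (f i)))) (sym (*-distribˡ-sumTo j x _))

    step : ∀ j → Y (suc j) ≐ Y j ⊕ A · shift 1 (Y (suc j)) ⊕ W · shift 1 (Y (suc (suc j)))
    step j zero    = begin
      Y (suc j) 0                 ≈⟨ trans (Y-suc j 0) (+-congˡ (S₁-at-0 j)) ⟩
      Y j 0 + 0#                  ≈⟨ +-identityʳ (Y j 0 + 0#) ⟨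
      (Y j 0 + 0#) + 0#           ≈⟨ +-cong (+-congˡ (zeroʳ A)) (zeroʳ W) ⟨
      (Y j 0 + A * 0#) + W * 0#   ∎
    step j (suc m) = begin
      Y (suc j) (suc m)
        ≈⟨ trans (Y-suc j (suc m)) (+-congˡ (S₁-suc j m)) ⟩
      Y j (suc m) + ((b * y + α * s₁) + W * s₂)
        ≈⟨ +-congˡ (+-congʳ (+-cong (*-congʳ b≈W+A) (*-congʳ (trans α≈W+b (+-congˡ b≈W+A))))) ⟩
      Y j (suc m) + (((W + A) * y + (W + (W + A)) * s₁) + W * s₂)
        ≈⟨ expand A W (Y j (suc m)) y s₁ s₂ ⟩
      (Y j (suc m) + A * (y + s₁)) + W * ((y + s₁) + (s₁ + s₂))
        ≈⟨ +-cong (+-congˡ (*-congˡ (Y-suc j m))) (*-congˡ (Y-suc-suc j m)) ⟨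
      (Y j (suc m) + A * Y (suc j) m) + W * Y (suc (suc j)) m
        ∎
      where
      y  = Y j m
      s₁ = S₁ j m
      s₂ = S₂ j m
      expand : ∀ A W y′ y s₁ s₂ →
        y′ + (((W + A) * y + (W + (W + A)) * s₁) + W * s₂) ≈ (y′ + A * (y + s₁)) + W * ((y + s₁) + (s₁ + s₂))
      expand = solve 6 (λ A W y′ y s₁ s₂ → y′ :+ (((W :+ A) :* y :+ (W :+ (W :+ A)) :* s₁) :+ W :* s₂)
                                        := (y′ :+ A :* (y :+ s₁)) :+ W :* ((y :+ s₁) :+ (s₁ :+ s₂))) refl

  rescale : Carrier → (ℕ → Series) → ℕ → Series
  rescale b Ψ i = b ^ i · shift i (Ψ i)

  -- With Ψ i = ψ^i, rescale b Ψ i = (b z ψ)^i; if ψ = 1 + α z ψ + b u z² ψ², then w = b z ψ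
  -- satisfies w = b z + α z w + u z w².
  rescale-step : ∀ {α b u} Ψ →
    (∀ i → Ψ (suc i) ≐ Ψ i ⊕ α · shift 1 (Ψ (suc i)) ⊕ (b * u) · shift 2 (Ψ (suc (suc i)))) →
    ∀ i → rescale b Ψ (suc i) ≐
      b · shift 1 (rescale b Ψ i) ⊕ α · shift 1 (rescale b Ψ (suc i)) ⊕ u · shift 1 (rescale b Ψ (suc (suc i)))
  rescale-step {α} {b} {u} Ψ Ψ-step i n = begin
    b ^ suc i * shift (suc i) (Ψ (suc i)) n
      ≈⟨ *-congˡ (shift-cong (suc i) (Ψ-step i) n) ⟩
    b ^ suc i * shift (suc i) (Ψ i ⊕ α · shift 1 (Ψ (suc i)) ⊕ (b * u) · shift 2 (Ψ (suc (suc i)))) n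
      ≈⟨ *-congˡ (trans (shift-⊕ (suc i) _ _ n)
           (+-cong (trans (shift-⊕ (suc i) _ _ n) (+-congˡ (shift-· (suc i) α _ n))) (shift-· (suc i) (b * u) _ n))) ⟩
    b ^ suc i * ((shift (suc i) (Ψ i) n + α * shift (suc i) (shift 1 (Ψ (suc i))) n) + (b * u) * shift (suc i) (shift 2 (Ψ (suc (suc i)))) n)
      ≈⟨ *-congˡ (+-cong (+-cong (shift-+ 1 i (Ψ i) n) (*-congˡ (shift-comm (suc i) 1 _ n))) (*-congˡ shift-2)) ⟩
    b ^ suc i * ((z₀ + α * z₁) + (b * u) * z₂)
      ≈⟨ regroup (b ^ i) b α u z₀ z₁ z₂ ⟩
    (b * (b ^ i * z₀) + α * (b ^ suc i * z₁)) + u * (b ^ suc (suc i) * z₂)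
      ≈⟨ +-cong (+-cong (*-congˡ (shift-· 1 (b ^ i) _ n)) (*-congˡ (shift-· 1 (b ^ suc i) _ n))) (*-congˡ (shift-· 1 (b ^ suc (suc i)) _ n)) ⟨
    (b * shift 1 (rescale b Ψ i) n + α * shift 1 (rescale b Ψ (suc i)) n) + u * shift 1 (rescale b Ψ (suc (suc i))) n
      ∎
    where
    z₀ = shift 1 (shift i (Ψ i)) n
    z₁ = shift 1 (shift (suc i) (Ψ (suc i))) n
    z₂ = shift 1 (shift (suc (suc i)) (Ψ (suc (suc i)))) n
    shift-2 : shift (suc i) (shift 2 (Ψ (suc (suc i)))) n ≈ z₂
    shift-2 = trans (sym (shift-+ (suc i) 2 _ n))
      (trans (reflexive (≡.cong (λ k → shift (suc k) (Ψ (suc (suc i))) n) (ℕ.+-comm i 2))) (shift-+ 1 (suc (suc i)) _ n))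
    regroup : ∀ B b α u z₀ z₁ z₂ →
      (b * B) * ((z₀ + α * z₁) + (b * u) * z₂) ≈ (b * (B * z₀) + α * ((b * B) * z₁)) + u * ((b * (b * B)) * z₂)
    regroup = solve 7 (λ B b α u z₀ z₁ z₂ → (b :* B) :* ((z₀ :+ α :* z₁) :+ (b :* u) :* z₂)
                                         := (b :* (B :* z₀) :+ α :* ((b :* B) :* z₁)) :+ u :* ((b :* (b :* B)) :* z₂)) refl

  substitution : ∀ u v b → b ≈ u + v → ∀ m →
    CatalanFamily.Φ 0 v u 1 (suc m) ≈ b * CatalanFamily.Φ 1 (u + b) (b * u) 1 m
  substitution u v b b≈u+v m = begin
    F.Φ 1 (suc m)                                          ≈⟨ RootPowers-unique F-roots Y-roots 1 (suc m) ⟩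
    1 × (1# * G.Φ 0 (suc m)) + 1 × ((b * 1#) * G.Φ 1 m)    ≈⟨ +-cong (trans (×-homo-1 _) (*-identityˡ _)) (×-homo-1 _) ⟩
    G.Φ 0 (suc m) + (b * 1#) * G.Φ 1 m                     ≈⟨ +-cong (G.Φ-zero (suc m)) (*-congʳ (*-identityʳ b)) ⟩
    0# + b * G.Φ 1 m                                       ≈⟨ +-identityˡ _ ⟩
    b * G.Φ 1 m                                            ∎
    where
    module F = CatalanFamily 0 v u
    module G = CatalanFamily 1 (u + b) (b * u)
    F-roots : RootPowers v u F.Φ
    F-roots = record { base = F.Φ-zero ; step = F.Φ-suc }
    Y-roots : RootPowers v u (binomialTransform (rescale b G.Φ))
    Y-roots = binomialTransform-RootPowers b≈u+v refl (rescale b G.Φ)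
                (λ n → trans (*-identityˡ _) (G.Φ-zero n)) (rescale-step G.Φ G.Φ-suc)

  Φ₁-coeff-linear : ∀ A W n →
    CatalanFamily.Φ 0 A W 1 n ≈ sumTo n (λ k → (((n +ℕ k) C (2 *ℕ k)) *ℕ catalan k) × (W ^ k * A ^ (n ∸ k)))
  Φ₁-coeff-linear A W n = trans (CatalanFamily.Φ₁-coeff 0 A W n) (sumTo-cong n (λ k _ → reflexive
    (≡.cong₂ (λ r k′ → ((r C (2 *ℕ k)) *ℕ catalan k) × (W ^ k * A ^ (n ∸ k′))) (row k) (ℕ.*-identityʳ k))))
    where
    row : ∀ k → (n +ℕ 2 *ℕ k) ∸ k *ℕ 1 ≡ n +ℕ k
    row k = ≡.trans (≡.cong₂ _∸_ (split n k) (ℕ.*-identityʳ k)) (ℕ.m+n∸n≡m (n +ℕ k) k)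
      where
      split : ∀ n k → n +ℕ 2 *ℕ k ≡ n +ℕ k +ℕ k
      split = solve-∀

  Φ₁-coeff-quadratic : ∀ A W m →
    CatalanFamily.Φ 1 A W 1 m ≈ sumTo m (λ k → ((m C (2 *ℕ k)) *ℕ catalan k) × (W ^ k * A ^ (m ∸ 2 *ℕ k)))
  Φ₁-coeff-quadratic A W m = trans (CatalanFamily.Φ₁-coeff 1 A W m) (sumTo-cong m (λ k _ → reflexive
    (≡.cong₂ (λ r k′ → ((r C (2 *ℕ k)) *ℕ catalan k) × (W ^ k * A ^ (m ∸ k′))) (row k) (ℕ.*-comm k 2))))
    where
    row : ∀ k → (m +ℕ 2 *ℕ k) ∸ k *ℕ 2 ≡ m
    row k = ≡.trans (≡.cong (m +ℕ 2 *ℕ k ∸_) (ℕ.*-comm k 2)) (ℕ.m+n∸n≡m m (2 *ℕ k))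


module MotzkinExpansion {c ℓ : Level} (R : CommutativeRing c ℓ) where
  open CommutativeRing R
  open RingDefs R
  open FiniteSums R
  open import Algebra.Properties.Monoid.Mult +-monoid using (×-congʳ; ×-assocˡ)
  open import Algebra.Properties.Semiring.Mult semiring using (×-comm-*; ×-assoc-*)
  open import Algebra.Properties.Semiring.Exp semiring using (^-homo-*)
  open import Algebra.Properties.CommutativeSemiring.Exp commutativeSemiring using (^-distrib-*)
  open import Algebra.Solver.Ring.NaturalCoefficients.Default commutativeSemiring using (solve; _:=_; _:+_; _:*_)
  open import Relation.Binary.Reasoning.Setoid setoid

  module _ (c : ℕ) (w a x y : Carrier) where
    private
      convolutionTerm : ℕ → ℕ → ℕ → Carrier
      convolutionTerm m p k = (m C k) × (((((k C p) *ℕ c) × (a ^ (k ∸ p) * w)) * x ^ k) * y ^ (m ∸ k))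

      convolutionTerm-vanish : ∀ m p k → k < p → convolutionTerm m p k ≈ 0#
      convolutionTerm-vanish m p k k<p = begin
        convolutionTerm m p k                                                  ≈⟨ ×-congʳ (m C k) (*-congʳ (*-congʳ (reflexive kCp*c≡0))) ⟩
        (m C k) × (((0 × (a ^ (k ∸ p) * w)) * x ^ k) * y ^ (m ∸ k))            ≈⟨ ×-congʳ (m C k) (trans (*-congʳ (zeroˡ _)) (zeroˡ _)) ⟩
        (m C k) × 0#                                                           ≈⟨ ×-zeroʳ (m C k) ⟩
        0#                                                                     ∎
        where kCp*c≡0 = ≡.cong (λ n → (n *ℕ c) × (a ^ (k ∸ p) * w)) (k>n⇒nCk≡0 k<p)

    binomial-convolution : ∀ m p → sumTo m (convolutionTerm m p) ≈ ((m C p) *ℕ c) × ((w * x ^ p) * (a * x + y) ^ (m ∸ p))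
    binomial-convolution m p with p ≤? m
    ... | no  p≰m = begin
      sumTo m (convolutionTerm m p)
        ≈⟨ sumTo-zero m (λ k k≤m → convolutionTerm-vanish m p k (ℕ.≤-<-trans k≤m (ℕ.≰⇒> p≰m))) ⟩
      0#
        ≈⟨ reflexive (≡.cong (λ n → (n *ℕ c) × ((w * x ^ p) * (a * x + y) ^ (m ∸ p))) (k>n⇒nCk≡0 (ℕ.≰⇒> p≰m))) ⟨
      ((m C p) *ℕ c) × ((w * x ^ p) * (a * x + y) ^ (m ∸ p))
        ∎
    ... | yes p≤m with ℕ.m≤n⇒∃[o]m+o≡n p≤m
    ...   | r , ≡.refl = begin
      sumTo (p +ℕ r) (convolutionTerm (p +ℕ r) p)
        ≈⟨ sumTo-drop p r _ (convolutionTerm-vanish (p +ℕ r) p) ⟩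
      sumTo r (λ i → convolutionTerm (p +ℕ r) p (p +ℕ i))
        ≈⟨ sumTo-cong r (λ i _ → regroup i) ⟩
      sumTo r (λ i → K × ((w * x ^ p) * ((r C i) × ((a * x) ^ i * y ^ (r ∸ i)))))
        ≈⟨ ×-distrib-sumTo r K _ ⟨
      K × sumTo r (λ i → (w * x ^ p) * ((r C i) × ((a * x) ^ i * y ^ (r ∸ i))))
        ≈⟨ ×-congʳ K (trans (sym (*-distribˡ-sumTo r (w * x ^ p) _)) (*-congˡ (binomial-theorem r (a * x) y))) ⟩
      K × ((w * x ^ p) * (a * x + y) ^ r)
        ≈⟨ reflexive (≡.cong (λ e → K × ((w * x ^ p) * (a * x + y) ^ e)) (ℕ.m+n∸m≡n p r)) ⟨
      K × ((w * x ^ p) * (a * x + y) ^ ((p +ℕ r) ∸ p))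
        ∎
      where
      K = ((p +ℕ r) C p) *ℕ c
      regroup : ∀ i → convolutionTerm (p +ℕ r) p (p +ℕ i) ≈ K × ((w * x ^ p) * ((r C i) × ((a * x) ^ i * y ^ (r ∸ i))))
      regroup i = begin
        N₁ × ((((N₂ *ℕ c) × (a ^ ((p +ℕ i) ∸ p) * w)) * x ^ (p +ℕ i)) * y ^ ((p +ℕ r) ∸ (p +ℕ i)))
          ≈⟨ ×-congʳ N₁ (trans (*-congʳ (×-assoc-* (N₂ *ℕ c) _ _)) (×-assoc-* (N₂ *ℕ c) _ _)) ⟩
        N₁ × ((N₂ *ℕ c) × (((a ^ ((p +ℕ i) ∸ p) * w) * x ^ (p +ℕ i)) * y ^ ((p +ℕ r) ∸ (p +ℕ i))))
          ≈⟨ ×-assocˡ _ N₁ (N₂ *ℕ c) ⟩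
        (N₁ *ℕ (N₂ *ℕ c)) × (((a ^ ((p +ℕ i) ∸ p) * w) * x ^ (p +ℕ i)) * y ^ ((p +ℕ r) ∸ (p +ℕ i)))
          ≈⟨ reflexive (≡.cong₂ (λ e f → (N₁ *ℕ (N₂ *ℕ c)) × (((a ^ e * w) * x ^ (p +ℕ i)) * y ^ f))
                                (ℕ.m+n∸m≡n p i) (ℕ.[m+n]∸[m+o]≡n∸o p r i)) ⟩
        (N₁ *ℕ (N₂ *ℕ c)) × (((a ^ i * w) * x ^ (p +ℕ i)) * y ^ (r ∸ i))
          ≈⟨ reflexive (≡.cong (_× (((a ^ i * w) * x ^ (p +ℕ i)) * y ^ (r ∸ i))) coefficient) ⟩
        (K *ℕ (r C i)) × (((a ^ i * w) * x ^ (p +ℕ i)) * y ^ (r ∸ i))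
          ≈⟨ ×-assocˡ _ K (r C i) ⟨
        K × ((r C i) × (((a ^ i * w) * x ^ (p +ℕ i)) * y ^ (r ∸ i)))
          ≈⟨ ×-congʳ K (trans (×-congʳ (r C i) monomial) (sym (×-comm-* (r C i) _ _))) ⟩
        K × ((w * x ^ p) * ((r C i) × ((a * x) ^ i * y ^ (r ∸ i))))
          ∎
        where
        N₁ = (p +ℕ r) C (p +ℕ i)
        N₂ = (p +ℕ i) C p
        coefficient : N₁ *ℕ (N₂ *ℕ c) ≡ K *ℕ (r C i)
        coefficient = ≡.trans (≡.sym (ℕ.*-assoc N₁ N₂ c)) (≡.trans (≡.cong (_*ℕ c) (C-trinomial p r i)) (swap ((p +ℕ r) C p) (r C i) c))
          where
          swap : ∀ a b c → (a *ℕ b) *ℕ c ≡ (a *ℕ c) *ℕ b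
          swap = solve-∀
        monomial : ((a ^ i * w) * x ^ (p +ℕ i)) * y ^ (r ∸ i) ≈ (w * x ^ p) * ((a * x) ^ i * y ^ (r ∸ i))
        monomial = trans (*-congʳ (*-congˡ (^-homo-* x p i)))
          (trans (reorder (a ^ i) w (x ^ p) (x ^ i) (y ^ (r ∸ i))) (*-congˡ (*-congʳ (sym (^-distrib-* a x i)))))
          where
          reorder : ∀ A W P Q Y → ((A * W) * (P * Q)) * Y ≈ (W * P) * ((A * Q) * Y)
          reorder = solve 5 (λ A W P Q Y → ((A :* W) :* (P :* Q)) :* Y := (W :* P) :* ((A :* Q) :* Y)) refl

  motzkin-binomial : ∀ a b x y m →
    sumTo m (λ k → (m C k) × ((motzkin a b k * x ^ k) * y ^ (m ∸ k)))
    ≈ sumTo m (λ j → ((m C (2 *ℕ j)) *ℕ catalan j) × ((b ^ j * x ^ (2 *ℕ j)) * (a * x + y) ^ (m ∸ 2 *ℕ j)))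
  motzkin-binomial a b x y m = begin
    sumTo m (λ k → (m C k) × ((motzkin a b k * x ^ k) * y ^ (m ∸ k)))
      ≈⟨ sumTo-cong m (λ k k≤m → ×-congʳ (m C k) (expand k k≤m)) ⟩
    sumTo m (λ k → (m C k) × sumTo m (λ j → (term k j * x ^ k) * y ^ (m ∸ k)))
      ≈⟨ sumTo-cong m (λ k _ → ×-distrib-sumTo m (m C k) _) ⟩
    sumTo m (λ k → sumTo m (λ j → (m C k) × ((term k j * x ^ k) * y ^ (m ∸ k))))
      ≈⟨ sumTo-comm m m _ ⟩
    sumTo m (λ j → sumTo m (λ k → (m C k) × ((term k j * x ^ k) * y ^ (m ∸ k))))
      ≈⟨ sumTo-cong m (λ j _ → binomial-convolution (catalan j) (b ^ j) a x y m (2 *ℕ j)) ⟩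
    sumTo m (λ j → ((m C (2 *ℕ j)) *ℕ catalan j) × ((b ^ j * x ^ (2 *ℕ j)) * (a * x + y) ^ (m ∸ 2 *ℕ j)))
      ∎
    where
    term : ℕ → ℕ → Carrier
    term k j = ((k C (2 *ℕ j)) *ℕ catalan j) × (a ^ (k ∸ 2 *ℕ j) * b ^ j)
    expand : ∀ k → k ≤ m → (motzkin a b k * x ^ k) * y ^ (m ∸ k) ≈ sumTo m (λ j → (term k j * x ^ k) * y ^ (m ∸ k))
    expand k k≤m = begin
      (motzkin a b k * x ^ k) * y ^ (m ∸ k)
        ≈⟨ *-congʳ (*-congʳ (sumTo-extend (term k) (ℕ.≤-trans (m/n≤m k 2) k≤m) term-vanish)) ⟨
      (sumTo m (term k) * x ^ k) * y ^ (m ∸ k)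
        ≈⟨ trans (*-congʳ (*-distribʳ-sumTo m _ _)) (*-distribʳ-sumTo m _ _) ⟩
      sumTo m (λ j → (term k j * x ^ k) * y ^ (m ∸ k))
        ∎
      where
      term-vanish : ∀ j → k / 2 < j → term k j ≈ 0#
      term-vanish j k/2<j = reflexive (≡.cong (λ n → (n *ℕ catalan j) × (a ^ (k ∸ 2 *ℕ j) * b ^ j)) (k>n⇒nCk≡0 (half<⇒<double k/2<j)))

theorem1p2 : ∀ {c ℓ : Level} (R : CommutativeRing c ℓ) →
    let open CommutativeRing R
        open RingDefs R
    in (n : ℕ) → 1 ≤ n → (a b x : Carrier) →
      sumTo n (λ k → (((n +ℕ k) C (2 *ℕ k)) *ℕ catalan k) × ((x ^ (2 *ℕ k)) * ((b - x ^ 2) ^ (n ∸ k))))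
      ≈ b * sumTo (n ∸ 1) (λ k → ((n ∸ 1) C k) × ((motzkin a b k * (x ^ k)) * (((x ^ 2 - a * x) + b) ^ ((n ∸ 1) ∸ k))))
theorem1p2 R (suc m) _ a b x = begin
  sumTo n (λ k → (((n +ℕ k) C (2 *ℕ k)) *ℕ catalan k) × (x ^ (2 *ℕ k) * v ^ (n ∸ k)))
    ≈⟨ sumTo-cong n (λ k _ → ×-congʳ (((n +ℕ k) C (2 *ℕ k)) *ℕ catalan k) (*-congʳ (sym (^-assocʳ x 2 k)))) ⟩
  sumTo n (λ k → (((n +ℕ k) C (2 *ℕ k)) *ℕ catalan k) × (u ^ k * v ^ (n ∸ k)))
    ≈⟨ Φ₁-coeff-linear v u n ⟨
  CatalanFamily.Φ 0 v u 1 n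
    ≈⟨ substitution u v b (sym (cancel u b)) m ⟩
  b * CatalanFamily.Φ 1 (u + b) (b * u) 1 m
    ≈⟨ *-congˡ (Φ₁-coeff-quadratic (u + b) (b * u) m) ⟩
  b * sumTo m (λ k → ((m C (2 *ℕ k)) *ℕ catalan k) × ((b * u) ^ k * (u + b) ^ (m ∸ 2 *ℕ k)))
    ≈⟨ *-congˡ (sumTo-cong m (λ k _ → ×-congʳ ((m C (2 *ℕ k)) *ℕ catalan k) (*-cong (bu^k k) (^-congˡ (m ∸ 2 *ℕ k) (sym ax+y≈u+b))))) ⟩
  b * sumTo m (λ k → ((m C (2 *ℕ k)) *ℕ catalan k) × ((b ^ k * x ^ (2 *ℕ k)) * (a * x + y) ^ (m ∸ 2 *ℕ k)))
    ≈⟨ *-congˡ (motzkin-binomial a b x y m) ⟨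
  b * sumTo m (λ k → (m C k) × ((motzkin a b k * x ^ k) * y ^ (m ∸ k)))
    ∎
  where
  open CommutativeRing R
  open RingDefs R
  open FiniteSums R
  open CatalanSeries R
  open MotzkinExpansion R
  open import Algebra.Properties.Monoid.Mult +-monoid using (×-congʳ)
  open import Algebra.Properties.Semiring.Exp semiring using (^-assocʳ; ^-congˡ)
  open import Algebra.Properties.CommutativeSemiring.Exp commutativeSemiring using (^-distrib-*)
  open import Algebra.Properties.AbelianGroup +-abelianGroup using (xyx⁻¹≈y)
  open import Relation.Binary.Reasoning.Setoid setoid
  n = suc m
  u = x ^ 2
  v = b - x ^ 2
  y = (x ^ 2 - a * x) + b
  cancel : ∀ z w → z + (w - z) ≈ w
  cancel z w = trans (sym (+-assoc z w (- z))) (xyx⁻¹≈y z w)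
  bu^k : ∀ k → (b * u) ^ k ≈ b ^ k * x ^ (2 *ℕ k)
  bu^k k = trans (^-distrib-* b u k) (*-congˡ (^-assocʳ x 2 k))
  ax+y≈u+b : a * x + y ≈ u + b
  ax+y≈u+b = trans (sym (+-assoc _ _ b)) (+-congʳ (cancel (a * x) u))
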